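{- Let $C=\{c_0,c_1,\ldots,c_k\}$ be a subset of the ground set of $M[P,Q]$ with $c_0<c_1<\cdots<c_k$, and let $n(C)=\{i_1,\ldots,i_s\}$ with $i_1<\cdots<i_s$. Then $C$ is a circuit of $M[P,Q]$ if and only if (1) $s=k$, (2) $c_0\in N_{i_1}$, (3) $c_k\in N_{i_k}$, and (4) $c_j\in N_{i_j}\cap N_{i_{j+1}}$ for all $j$ with $0<j<k$. Furthermore, if $C$ is a circuit, then $i_{h+1}=i_h+1$ for $1\le h<k$.
   Context: Lattice paths start at $(0,0)$ and use steps $E=(1,0)$ and $N=(0,1)$. For lattice paths $P,Q$ from $(0,0)$ to $(m,r)$ with $P$ never going above $Q$, let $\mathcal{P}$ be the set of lattice paths from $(0,0)$ to $(m,r)$ going neither above $Q$ nor below $P$, and for $1\le i\le r$ let $N_i=\{j:\text{step } j \text{ is the } i\text{ -th North step of some path in }\mathcal{P}\}$. $M[P,Q]$ is the transversal matroid on $[m+r]$ with presentation $(N_1,\ldots,N_r)$, with the natural order on $[m+r]$. Its incidence function is $n(X)=\{i\in[r]: X\cap N_i\neq\emptyset\}$. -}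

module Defs where

open import Data.Nat using (ℕ; zero; suc; _+_; _≤_; _<_)
open import Data.List using (List; []; _∷_; length)
open import Data.Maybe using (Maybe; just; nothing)
open import Data.Product using (Σ; ∃; _×_; _,_)
open import Relation.Nullary using (¬_)
open import Relation.Binary.PropositionalEquality using (_≡_)

-- Steps of a lattice path: E = (1,0), N = (0,1).
data Step : Set where
  E N : Step

ht : ℕ → List Step → ℕ
ht zero    _       = 0
ht (suc t) []      = 0
ht (suc t) (N ∷ w) = suc (ht t w)
ht (suc t) (E ∷ w) = ht t w

numN : List Step → ℕ
numN []      = 0
numN (N ∷ w) = suc (numN w)
numN (E ∷ w) = numN w

-- step j of w, 1-indexed (nothing if j = 0 or j > length w)
stepAt : List Step → ℕ → Maybe Step
stepAt []      _             = nothing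
stepAt (s ∷ w) zero          = nothing
stepAt (s ∷ w) (suc zero)    = just s
stepAt (s ∷ w) (suc (suc j)) = stepAt w (suc j)

record LatticePath (m r : ℕ) : Set where
  constructor mkPath
  field
    steps  : List Step
    len    : length steps ≡ m + r
    norths : numN steps ≡ r
open LatticePath public

Below : ∀ {m r} → LatticePath m r → LatticePath m r → Set
Below R Q = ∀ t → ht t (steps R) ≤ ht t (steps Q)

Subset : Set₁
Subset = ℕ → Set

_⊆_ : Subset → Subset → Set
X ⊆ Y = ∀ x → X x → Y x

module LPM {m r : ℕ} (P Q : LatticePath m r) where

  InPcal : LatticePath m r → Set
  InPcal R = Below P R × Below R Q

  -- InN i j  :⇔  j ∈ N_i : step j is the i-th North step of some path in 𝒫
  InN : ℕ → ℕ → Set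
  InN i j = Σ (LatticePath m r) λ R →
              InPcal R × stepAt (steps R) j ≡ just N × ht j (steps R) ≡ i

  Ground : Subset
  Ground x = 1 ≤ x × x ≤ m + r

  -- independent sets of the transversal matroid with presentation
  -- (N_1,…,N_r): partial transversals, i.e. X admits an injective
  -- map f into [r] with x ∈ N_{f x}.
  Independent : Subset → Set
  Independent X =
    Σ (ℕ → ℕ) λ f →
      (∀ x → X x → 1 ≤ f x × f x ≤ r × InN (f x) x) ×
      (∀ x y → X x → X y → f x ≡ f y → x ≡ y)

  Circuit : Subset → Set₁
  Circuit C =
    (C ⊆ Ground) × ¬ Independent C ×
    (∀ (Y : Subset) → Y ⊆ C → (∃ λ x → C x × ¬ Y x) → Independent Y)

  incid : Subset → Subset
  incid X i = 1 ≤ i × i ≤ r × ∃ λ x → X x × InN i x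

{-# OPTIONS --safe #-}
-- Put lower x = height of P before step x and upper x = height of Q after step x. Then step x
-- lies in N_i exactly when lower x < i ≤ upper x, so each element carries an interval of
-- admissible indices whose endpoints grow with the element. Write (p j, q j] for the interval of
-- c j. If C is a circuit, every proper consecutive block c l … c (l + n) is independent, so by
-- pigeonhole its intervals span more than n indices; if C itself did, a greedy matching would make
-- C independent. Hence q k ≤ p 0 + k, and n(C) is exactly (p 0, p 0 + k]: this forces s = k,
-- i h = p 0 + h, and the zigzag memberships c j ∈ N_(i j) ∩ N_(i (j + 1)). Conversely the zigzag
-- matches C minus any c a (shifting indices below a), while k + 1 elements cannot be matched into
-- the k indices of n(C).
module Submission where

open import Defs
open import Data.Nat
  using (ℕ; zero; suc; _+_; _≤_; _<_; _∸_; _⊓_; _⊔_; pred; z≤n; s≤s; _≤?_; _<?_; _≟_)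
open import Data.Nat.Properties
open import Data.Fin using (Fin; toℕ; fromℕ<)
open import Data.Fin.Properties
  using (toℕ-injective; toℕ-fromℕ<; toℕ≤pred[n]; injective⇒≤; any?)
open import Data.List using (List; []; _∷_; length)
open import Data.Maybe using (just)
open import Data.Product using (Σ; ∃; _×_; _,_; proj₁; proj₂)
open import Data.Sum using (_⊎_; inj₁; inj₂)
open import Data.Empty using (⊥-elim)
open import Function using (_∘_)
open import Function.Definitions using (Injective)
open import Relation.Nullary using (¬_; yes; no)
open import Relation.Binary using (tri<; tri≈; tri>)
open import Relation.Binary.PropositionalEquality
  using (_≡_; _≢_; refl; sym; trans; cong; subst; module ≡-Reasoning)

UnitStep : (ℕ → ℕ) → ℕ → Set
UnitStep g t = g t ≤ g (suc t) × g (suc t) ≤ suc (g t)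

unitStep-⊓ : ∀ f g {t} → UnitStep f t → UnitStep g t → UnitStep (λ u → f u ⊓ g u) t
unitStep-⊓ _ _ (f↑ , f↑≤1) (g↑ , g↑≤1) = ⊓-mono-≤ f↑ g↑ , ⊓-mono-≤ f↑≤1 g↑≤1

unitStep-⊔ : ∀ f g {t} → UnitStep f t → UnitStep g t → UnitStep (λ u → f u ⊔ g u) t
unitStep-⊔ _ _ (f↑ , f↑≤1) (g↑ , g↑≤1) = ⊔-mono-≤ f↑ g↑ , ⊔-mono-≤ f↑≤1 g↑≤1

unitStep-flat : ∀ {g t} → UnitStep g t → g (suc t) ≢ suc (g t) → g (suc t) ≡ g t
unitStep-flat (g↑ , g↑≤1) g↑≢1 = ≤-antisym (≤-pred (≤∧≢⇒< g↑≤1 g↑≢1)) g↑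

ht-unitStep : ∀ w t → UnitStep (λ u → ht u w) t
ht-unitStep []      zero    = z≤n , z≤n
ht-unitStep (N ∷ w) zero    = z≤n , s≤s z≤n
ht-unitStep (E ∷ w) zero    = z≤n , z≤n
ht-unitStep []      (suc t) = z≤n , z≤n
ht-unitStep (N ∷ w) (suc t) = s≤s (proj₁ (ht-unitStep w t)) , s≤s (proj₂ (ht-unitStep w t))
ht-unitStep (E ∷ w) (suc t) = ht-unitStep w t

ht-mono : ∀ w {t u} → t ≤ u → ht t w ≤ ht u w
ht-mono w       {zero}              _         = z≤n
ht-mono []      {suc t} {suc u} _         = z≤n
ht-mono (N ∷ w) {suc t} {suc u} (s≤s t≤u) = s≤s (ht-mono w t≤u)
ht-mono (E ∷ w) {suc t} {suc u} (s≤s t≤u) = ht-mono w t≤u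

ht≤numN : ∀ w t → ht t w ≤ numN w
ht≤numN w       zero    = z≤n
ht≤numN []      (suc t) = z≤n
ht≤numN (N ∷ w) (suc t) = s≤s (ht≤numN w t)
ht≤numN (E ∷ w) (suc t) = ht≤numN w t

ht-beyond : ∀ w t → length w ≤ t → ht t w ≡ numN w
ht-beyond []      zero    _         = refl
ht-beyond []      (suc t) _         = refl
ht-beyond (N ∷ w) (suc t) (s≤s w≤t) = cong suc (ht-beyond w t w≤t)
ht-beyond (E ∷ w) (suc t) (s≤s w≤t) = ht-beyond w t w≤t

stepAt≡N⇒ht-suc : ∀ w j → stepAt w j ≡ just N → ht j w ≡ suc (ht (pred j) w)
stepAt≡N⇒ht-suc []      j             ()
stepAt≡N⇒ht-suc (s ∷ w) zero          ()
stepAt≡N⇒ht-suc (N ∷ w) (suc zero)    _  = refl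
stepAt≡N⇒ht-suc (E ∷ w) (suc zero)    ()
stepAt≡N⇒ht-suc (N ∷ w) (suc (suc j)) e  = cong suc (stepAt≡N⇒ht-suc w (suc j) e)
stepAt≡N⇒ht-suc (E ∷ w) (suc (suc j)) e  = stepAt≡N⇒ht-suc w (suc j) e

ht-suc⇒stepAt≡N : ∀ w j → ht j w ≡ suc (ht (pred j) w) → stepAt w j ≡ just N
ht-suc⇒stepAt≡N w       zero          ()
ht-suc⇒stepAt≡N []      (suc j)       ()
ht-suc⇒stepAt≡N (N ∷ w) (suc zero)    _  = refl
ht-suc⇒stepAt≡N (E ∷ w) (suc zero)    ()
ht-suc⇒stepAt≡N (N ∷ w) (suc (suc j)) e  = ht-suc⇒stepAt≡N w (suc j) (suc-injective e)
ht-suc⇒stepAt≡N (E ∷ w) (suc (suc j)) e  = ht-suc⇒stepAt≡N w (suc j) e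

ht≤r : ∀ {m r} (S : LatticePath m r) t → ht t (steps S) ≤ r
ht≤r S t = subst (ht t (steps S) ≤_) (norths S) (ht≤numN (steps S) t)

ht-end : ∀ {m r} (S : LatticePath m r) t → m + r ≤ t → ht t (steps S) ≡ r
ht-end S t m+r≤t =
  trans (ht-beyond (steps S) t (subst (_≤ t) (sym (len S)) m+r≤t)) (norths S)

stepTo : ℕ → ℕ → Step
stepTo a b with b ≟ suc a
... | yes _ = N
... | no _  = E

fromHeights : (ℕ → ℕ) → ℕ → List Step
fromHeights g zero    = []
fromHeights g (suc n) = stepTo (g 0) (g 1) ∷ fromHeights (g ∘ suc) n

length-fromHeights : ∀ g n → length (fromHeights g n) ≡ n
length-fromHeights g zero    = refl
length-fromHeights g (suc n) = cong suc (length-fromHeights (g ∘ suc) n)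

ht-fromHeights : ∀ g n → (∀ t → t < n → UnitStep g t) →
                 ∀ t → t ≤ n → ht t (fromHeights g n) + g 0 ≡ g t
ht-fromHeights g n       unit zero    _         = refl
ht-fromHeights g (suc n) unit (suc t) (s≤s t≤n) with g 1 ≟ suc (g 0)
... | yes up = begin
  suc (ht t w) + g 0 ≡⟨ sym (+-suc (ht t w) (g 0)) ⟩
  ht t w + suc (g 0) ≡⟨ cong (ht t w +_) (sym up) ⟩
  ht t w + g 1       ≡⟨ ih ⟩
  g (suc t)          ∎
  where
  open ≡-Reasoning
  w = fromHeights (g ∘ suc) n
  ih = ht-fromHeights (g ∘ suc) n (λ u u<n → unit (suc u) (s≤s u<n)) t t≤n
... | no flat = begin
  ht t w + g 0 ≡⟨ cong (ht t w +_) (sym (unitStep-flat {g} (unit 0 (s≤s z≤n)) flat)) ⟩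
  ht t w + g 1 ≡⟨ ih ⟩
  g (suc t)    ∎
  where
  open ≡-Reasoning
  w = fromHeights (g ∘ suc) n
  ih = ht-fromHeights (g ∘ suc) n (λ u u<n → unit (suc u) (s≤s u<n)) t t≤n

pathWithHeights : ∀ {m r} (g : ℕ → ℕ) → g 0 ≡ 0 → (∀ t → UnitStep g t) →
                  (∀ t → m + r ≤ t → g t ≡ r) →
                  Σ (LatticePath m r) λ R → ∀ t → ht t (steps R) ≡ g t
pathWithHeights {m} {r} g g0≡0 unit end = mkPath w length-w numN-w , ht-w
  where
  w = fromHeights g (m + r)
  length-w = length-fromHeights g (m + r)
  ht-w-upTo : ∀ t → t ≤ m + r → ht t w ≡ g t
  ht-w-upTo t t≤m+r = begin
    ht t w       ≡⟨ sym (+-identityʳ (ht t w)) ⟩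
    ht t w + 0   ≡⟨ cong (ht t w +_) (sym g0≡0) ⟩
    ht t w + g 0 ≡⟨ ht-fromHeights g (m + r) (λ u _ → unit u) t t≤m+r ⟩
    g t          ∎
    where open ≡-Reasoning
  numN-w : numN w ≡ r
  numN-w = begin
    numN w       ≡⟨ sym (ht-beyond w (m + r) (≤-reflexive length-w)) ⟩
    ht (m + r) w ≡⟨ ht-w-upTo (m + r) ≤-refl ⟩
    g (m + r)    ≡⟨ end (m + r) ≤-refl ⟩
    r            ∎
    where open ≡-Reasoning
  ht-w : ∀ t → ht t w ≡ g t
  ht-w t with t ≤? m + r
  ... | yes t≤m+r = ht-w-upTo t t≤m+r
  ... | no t≰m+r  = trans (ht-beyond w t (subst (_≤ t) (sym length-w) m+r≤t))
                          (trans numN-w (sym (end t m+r≤t)))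
    where m+r≤t = <⇒≤ (≰⇒> t≰m+r)

jump : ℕ → ℕ → ℕ → ℕ
jump x a t with t ≤? x
... | yes _ = a
... | no _  = suc a

jump-unitStep : ∀ x a t → UnitStep (jump x a) t
jump-unitStep x a t with t ≤? x | suc t ≤? x
... | yes _   | yes _    = ≤-refl , n≤1+n a
... | yes _   | no _     = n≤1+n a , ≤-refl
... | no t≰x  | yes t<x  = ⊥-elim (t≰x (<⇒≤ t<x))
... | no _    | no _     = ≤-refl , n≤1+n (suc a)

jump-before : ∀ x a → jump x a x ≡ a
jump-before x a with x ≤? x
... | yes _   = refl
... | no x≰x  = ⊥-elim (x≰x ≤-refl)

jump-after : ∀ x a → jump x a (suc x) ≡ suc a
jump-after x a with suc x ≤? x
... | yes x<x = ⊥-elim (<-irrefl refl x<x)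
... | no _    = refl

clamp-inside : ∀ {a b v} → a ≤ v → v ≤ b → b ⊓ (a ⊔ v) ≡ v
clamp-inside {b = b} a≤v v≤b = trans (cong (b ⊓_) (m≤n⇒m⊔n≡n a≤v)) (m≥n⇒m⊓n≡n v≤b)

module NSets {m r : ℕ} (P Q : LatticePath m r) (P≤Q : Below P Q) where
  open LPM P Q

  lower upper : ℕ → ℕ
  lower x = ht (pred x) (steps P)
  upper x = ht x (steps Q)

  lower-mono : ∀ {x y} → x ≤ y → lower x ≤ lower y
  lower-mono x≤y = ht-mono (steps P) (∸-monoˡ-≤ 1 x≤y)

  upper-mono : ∀ {x y} → x ≤ y → upper x ≤ upper y
  upper-mono = ht-mono (steps Q)

  InN⇒bounds : ∀ {i x} → InN i x → lower x < i × i ≤ upper x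
  InN⇒bounds {i} {x} (R , (P≤R , R≤Q) , x-north , htR≡i) =
    lower<i , subst (_≤ upper x) htR≡i (R≤Q x)
    where
    open ≤-Reasoning
    lower<i : lower x < i
    lower<i = begin-strict
      lower x                      ≤⟨ P≤R (pred x) ⟩
      ht (pred x) (steps R)        <⟨ n<1+n _ ⟩
      suc (ht (pred x) (steps R))  ≡⟨ stepAt≡N⇒ht-suc (steps R) x x-north ⟨
      ht x (steps R)               ≡⟨ htR≡i ⟩
      i                            ∎

  -- R follows the step function rising from h to suc h at step suc x, clamped between P and Q.
  bounds⇒InN : ∀ {i x} → lower x < i → i ≤ upper x → InN i x
  bounds⇒InN {suc h} {zero}  _         ()
  bounds⇒InN {suc h} {suc x} (s≤s P≤h) h<Q =
    R , (P≤R , R≤Q) , x-north , trans (htR (suc x)) g-after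
    where
    hP hQ g : ℕ → ℕ
    hP t = ht t (steps P)
    hQ t = ht t (steps Q)
    g t = hQ t ⊓ (hP t ⊔ jump x h t)

    g-unitStep : ∀ t → UnitStep g t
    g-unitStep t = unitStep-⊓ hQ (λ u → hP u ⊔ jump x h u) (ht-unitStep (steps Q) t)
                     (unitStep-⊔ hP (jump x h) (ht-unitStep (steps P) t) (jump-unitStep x h t))

    g-end : ∀ t → m + r ≤ t → g t ≡ r
    g-end t m+r≤t rewrite ht-end Q t m+r≤t | ht-end P t m+r≤t = m≤n⇒m⊓n≡m (m≤m⊔n r _)

    R = proj₁ (pathWithHeights g refl g-unitStep g-end)
    htR = proj₂ (pathWithHeights g refl g-unitStep g-end)

    P≤R : Below P R
    P≤R t = subst (hP t ≤_) (sym (htR t)) (⊓-glb (P≤Q t) (m≤m⊔n (hP t) _))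

    R≤Q : Below R Q
    R≤Q t = subst (_≤ hQ t) (sym (htR t)) (m⊓n≤m (hQ t) _)

    g-before : g x ≡ h
    g-before = trans (cong (λ v → hQ x ⊓ (hP x ⊔ v)) (jump-before x h))
                     (clamp-inside P≤h (≤-pred (≤-trans h<Q (proj₂ (ht-unitStep (steps Q) x)))))

    g-after : g (suc x) ≡ suc h
    g-after = trans (cong (λ v → hQ (suc x) ⊓ (hP (suc x) ⊔ v)) (jump-after x h))
                    (clamp-inside (≤-trans (proj₂ (ht-unitStep (steps P) x)) (s≤s P≤h)) h<Q)

    x-north : stepAt (steps R) (suc x) ≡ just N
    x-north = ht-suc⇒stepAt≡N (steps R) (suc x)
                (trans (htR (suc x)) (trans g-after (cong suc (sym (trans (htR x) g-before)))))

  InN⇒range : ∀ {i x} → InN i x → 1 ≤ i × i ≤ r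
  InN⇒range {x = x} x∈Nᵢ with InN⇒bounds x∈Nᵢ
  ... | lower<i , i≤upper = ≤-trans (s≤s z≤n) lower<i , ≤-trans i≤upper (ht≤r Q x)

module _ {f : ℕ → ℕ} {a b : ℕ} (f-inc : ∀ h → a ≤ h → h < b → f h < f (suc h)) where

  increasing-< : ∀ {h h'} → a ≤ h → h < h' → h' ≤ b → f h < f h'
  increasing-< {h} {suc h'} a≤h (s≤s h≤h') h'<b with m≤n⇒m<n∨m≡n h≤h'
  ... | inj₂ refl = f-inc h a≤h h'<b
  ... | inj₁ h<h' = <-trans (increasing-< a≤h h<h' (<⇒≤ h'<b))
                            (f-inc h' (≤-trans a≤h (<⇒≤ h<h')) h'<b)

  increasing-≤ : ∀ {h h'} → a ≤ h → h ≤ h' → h' ≤ b → f h ≤ f h'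
  increasing-≤ a≤h h≤h' h'≤b with m≤n⇒m<n∨m≡n h≤h'
  ... | inj₁ h<h'  = <⇒≤ (increasing-< a≤h h<h' h'≤b)
  ... | inj₂ refl  = ≤-refl

  increasing-cancel-< : ∀ {h h'} → a ≤ h' → h ≤ b → f h < f h' → h < h'
  increasing-cancel-< {h} {h'} a≤h' h≤b fh<fh' with h <? h'
  ... | yes h<h' = h<h'
  ... | no h≮h'  = ⊥-elim (<⇒≱ fh<fh' (increasing-≤ a≤h' (≮⇒≥ h≮h') h≤b))

  increasing-injective : ∀ {h h'} → a ≤ h → a ≤ h' → h ≤ b → h' ≤ b →
                         f h ≡ f h' → h ≡ h'
  increasing-injective {h} {h'} a≤h a≤h' h≤b h'≤b fh≡fh' with <-cmp h h'
  ... | tri< h<h' _ _ = ⊥-elim (<-irrefl fh≡fh' (increasing-< a≤h h<h' h'≤b))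
  ... | tri≈ _ h≡h' _ = h≡h'
  ... | tri> _ _ h'<h = ⊥-elim (<-irrefl (sym fh≡fh') (increasing-< a≤h' h'<h h≤b))

pigeonhole-interval : ∀ {b n} (g : Fin (suc n) → ℕ) → (∀ x → b ≤ g x × g x < b + n) →
                      ¬ Injective _≡_ _≡_ g
pigeonhole-interval {b} {n} g g∈ g-injective = 1+n≰n (injective⇒≤ offset-injective)
  where
  offset< : ∀ x → g x ∸ b < n
  offset< x = subst (g x ∸ b <_) (m+n∸m≡n b n) (∸-monoˡ-< (proj₂ (g∈ x)) (proj₁ (g∈ x)))
  offset : Fin (suc n) → Fin n
  offset x = fromℕ< (offset< x)
  offset-injective : Injective _≡_ _≡_ offset
  offset-injective {x} {y} e = g-injective (∸-cancelʳ-≡ (proj₁ (g∈ x)) (proj₁ (g∈ y))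
    (trans (sym (toℕ-fromℕ< (offset< x))) (trans (cong toℕ e) (toℕ-fromℕ< (offset< y)))))

_≐_ : Subset → Subset → Set
X ≐ Y = ∀ x → (X x → Y x) × (Y x → X x)

Interval : ℕ → ℕ → Subset
Interval a b x = a < x × x ≤ b

Image : (ℕ → ℕ) → ℕ → Subset
Image i s x = ∃ λ h → 1 ≤ h × h ≤ s × i h ≡ x

module IntervalEnumeration {i : ℕ → ℕ} {s a k : ℕ}
  (i-inc : ∀ h → 1 ≤ h → h < s → i h < i (suc h))
  (image : Image i s ≐ Interval a (a + k)) where

  private
    i-in : ∀ h → 1 ≤ h → h ≤ s → Interval a (a + k) (i h)
    i-in h 1≤h h≤s = proj₁ (image (i h)) (h , 1≤h , h≤s , refl)

    -- suc b lies in the interval, so it is some i h', and h' is past h.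
    next-value : ∀ h b → suc h ≤ s → a ≤ b → b < i (suc h) →
                 (∀ h' → 1 ≤ h' → h' ≤ s → b < i h' → suc h ≤ h') → i (suc h) ≡ suc b
    next-value h b h<s a≤b b<i above-b
      with proj₂ (image (suc b)) (s≤s a≤b , ≤-trans b<i (proj₂ (i-in (suc h) (s≤s z≤n) h<s)))
    ... | h' , 1≤h' , h'≤s , ih'≡ = ≤-antisym (subst (i (suc h) ≤_) ih'≡ i≤ih') b<i
      where
      i≤ih' : i (suc h) ≤ i h'
      i≤ih' = increasing-≤ i-inc (s≤s z≤n)
                (above-b h' 1≤h' h'≤s (≤-reflexive (sym ih'≡))) h'≤s

    first-value : 1 ≤ s → i 1 ≡ a + 1
    first-value 1≤s =
      trans (next-value 0 a 1≤s ≤-refl (proj₁ (i-in 1 ≤-refl 1≤s)) (λ _ 1≤h' _ _ → 1≤h'))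
            (+-comm 1 a)

    next-value-consecutive : ∀ h → 1 ≤ h → h < s → i h ≡ a + h → i (suc h) ≡ a + suc h
    next-value-consecutive h 1≤h h<s ih≡ =
      trans (next-value h (a + h) h<s (m≤m+n a h) a+h<i above) (sym (+-suc a h))
      where
      a+h<i : a + h < i (suc h)
      a+h<i = subst (_< i (suc h)) ih≡ (i-inc h 1≤h h<s)
      above : ∀ h' → 1 ≤ h' → h' ≤ s → a + h < i h' → suc h ≤ h'
      above h' 1≤h' _ a+h<ih' =
        increasing-cancel-< i-inc 1≤h' (<⇒≤ h<s) (subst (_< i h') (sym ih≡) a+h<ih')

  values : ∀ h → 1 ≤ h → h ≤ s → i h ≡ a + h
  values (suc zero)    _ 1≤s = first-value 1≤s
  values (suc (suc h)) _ h<s =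
    next-value-consecutive (suc h) (s≤s z≤n) h<s (values (suc h) (s≤s z≤n) (<⇒≤ h<s))

  size : s ≡ k
  size with <-cmp s k
  ... | tri≈ _ s≡k _ = s≡k
  ... | tri> _ _ k<s = ⊥-elim (<⇒≱ k<s (+-cancelˡ-≤ a s k a+s≤a+k))
    where
    1≤s = ≤-trans (s≤s z≤n) k<s
    a+s≤a+k = subst (_≤ a + k) (values s 1≤s ≤-refl) (proj₂ (i-in s 1≤s ≤-refl))
  ... | tri< s<k _ _ with proj₂ (image (a + suc s)) (a<a+1+s , +-monoʳ-≤ a s<k)
    where a<a+1+s = subst (a <_) (sym (+-suc a s)) (s≤s (m≤m+n a s))
  ... | h , 1≤h , h≤s , ih≡ = ⊥-elim (1+n≰n (subst (_≤ s) h≡1+s h≤s))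
    where h≡1+s = +-cancelˡ-≡ a h (suc s) (trans (sym (values h 1≤h h≤s)) ih≡)

≮∧≢⇒> : ∀ {t a} → ¬ t < a → t ≢ a → a < t
≮∧≢⇒> t≮a t≢a = ≤∧≢⇒< (≮⇒≥ t≮a) (t≢a ∘ sym)

skip : ℕ → ℕ → ℕ
skip a t with t <? a
... | yes _ = suc t
... | no _  = t

skip-cases : ∀ a t → t ≢ a → (t < a × skip a t ≡ suc t) ⊎ (a < t × skip a t ≡ t)
skip-cases a t t≢a with t <? a
... | yes t<a = inj₁ (t<a , refl)
... | no t≮a  = inj₂ (≮∧≢⇒> t≮a t≢a , refl)

skip-injective : ∀ {a t t'} → t ≢ a → t' ≢ a → skip a t ≡ skip a t' → t ≡ t'
skip-injective {a} {t} {t'} t≢a t'≢a e with skip-cases a t t≢a | skip-cases a t' t'≢a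
... | inj₁ (_ , e₁)   | inj₁ (_ , e₂)    = suc-injective (trans (sym e₁) (trans e e₂))
... | inj₂ (_ , e₁)   | inj₂ (_ , e₂)    = trans (sym e₁) (trans e e₂)
... | inj₁ (t<a , e₁) | inj₂ (a<t' , e₂) =
  ⊥-elim (<⇒≱ a<t' (subst (_≤ a) (trans (sym e₁) (trans e e₂)) t<a))
... | inj₂ (a<t , e₁) | inj₁ (t'<a , e₂) =
  ⊥-elim (<⇒≱ a<t (subst (_≤ a) (trans (sym e₂) (trans (sym e) e₁)) t'<a))

skip-range : ∀ {a n t} → a ≤ n → t ≤ n → t ≢ a → 1 ≤ skip a t × skip a t ≤ n
skip-range {a} {n} {t} a≤n t≤n t≢a with t <? a
... | yes t<a = s≤s z≤n , <-≤-trans t<a a≤n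
... | no t≮a  = ≤-<-trans z≤n (≮∧≢⇒> t≮a t≢a) , t≤n

module Chain {m r : ℕ} (P Q : LatticePath m r) (P≤Q : Below P Q)
             {k : ℕ} {c : ℕ → ℕ} (c-inc : ∀ j → j < k → c j < c (suc j)) where
  open LPM P Q
  open NSets P Q P≤Q

  C : Subset
  C y = ∃ λ j → j ≤ k × c j ≡ y

  p q : ℕ → ℕ
  p j = lower (c j)
  q j = upper (c j)

  c-injective : ∀ {j j'} → j ≤ k → j' ≤ k → c j ≡ c j' → j ≡ j'
  c-injective = increasing-injective (λ j _ → c-inc j) z≤n z≤n

  p-mono : ∀ {j j'} → j ≤ j' → j' ≤ k → p j ≤ p j'
  p-mono j≤j' j'≤k = lower-mono (increasing-≤ (λ j _ → c-inc j) z≤n j≤j' j'≤k)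

  q-mono : ∀ {j j'} → j ≤ j' → j' ≤ k → q j ≤ q j'
  q-mono j≤j' j'≤k = upper-mono (increasing-≤ (λ j _ → c-inc j) z≤n j≤j' j'≤k)

  index : ℕ → ℕ
  index y with any? (λ (j : Fin (suc k)) → c (toℕ j) ≟ y)
  ... | yes (j , _) = toℕ j
  ... | no _        = 0

  index-c : ∀ {j} → j ≤ k → index (c j) ≡ j
  index-c {j} j≤k with any? (λ (j' : Fin (suc k)) → c (toℕ j') ≟ c j)
  ... | yes (j' , e) = c-injective (toℕ≤pred[n] j') j≤k e
  ... | no ∄         = ⊥-elim (∄ (fromℕ< (s≤s j≤k) , cong c (toℕ-fromℕ< (s≤s j≤k))))

  matching⇒independent : ∀ (Y : Subset) → Y ⊆ C → (φ : ℕ → ℕ) →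
    (∀ j → j ≤ k → Y (c j) → InN (φ j) (c j)) →
    (∀ j j' → j ≤ k → j' ≤ k → Y (c j) → Y (c j') → φ j ≡ φ j' → j ≡ j') →
    Independent Y
  matching⇒independent Y Y⊆C φ matched φ-injective = φ ∘ index , into , injective
    where
    into : ∀ y → Y y → 1 ≤ φ (index y) × φ (index y) ≤ r × InN (φ (index y)) y
    into y Yy with Y⊆C y Yy
    ... | j , j≤k , refl rewrite index-c j≤k =
      let y∈N = matched j j≤k Yy in proj₁ (InN⇒range y∈N) , proj₂ (InN⇒range y∈N) , y∈N
    injective : ∀ y y' → Y y → Y y' → φ (index y) ≡ φ (index y') → y ≡ y'
    injective y y' Yy Yy' e with Y⊆C y Yy | Y⊆C y' Yy'
    ... | j , j≤k , refl | j' , j'≤k , refl rewrite index-c j≤k | index-c j'≤k =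
      cong c (φ-injective j j' j≤k j'≤k Yy Yy' e)

  Block : ℕ → ℕ → Subset
  Block l n y = ∃ λ u → u ≤ n × c (l + u) ≡ y

  Wide : ℕ → ℕ → Set
  Wide l n = p l + n < q (l + n)

  independent⇒wide : ∀ l n → l + n ≤ k → Independent (Block l n) → Wide l n
  independent⇒wide l n l+n≤k (f , into , f-injective) with p l + n <? q (l + n)
  ... | yes wide  = wide
  ... | no narrow = ⊥-elim (pigeonhole-interval g g∈ g-injective)
    where
    bound : (u : Fin (suc n)) → l + toℕ u ≤ k
    bound u = ≤-trans (+-monoʳ-≤ l (toℕ≤pred[n] u)) l+n≤k
    member : (u : Fin (suc n)) → Block l n (c (l + toℕ u))
    member u = toℕ u , toℕ≤pred[n] u , refl
    g : Fin (suc n) → ℕ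
    g u = f (c (l + toℕ u))
    g∈ : ∀ u → suc (p l) ≤ g u × g u < suc (p l) + n
    g∈ u with InN⇒bounds (proj₂ (proj₂ (into _ (member u))))
    ... | lower<g , g≤upper =
      ≤-<-trans (p-mono (m≤m+n l (toℕ u)) (bound u)) lower<g ,
      s≤s (≤-trans g≤upper
            (≤-trans (q-mono (+-monoʳ-≤ l (toℕ≤pred[n] u)) l+n≤k) (≮⇒≥ narrow)))
    g-injective : Injective _≡_ _≡_ g
    g-injective {u} {v} e = toℕ-injective (+-cancelˡ-≡ l (toℕ u) (toℕ v)
      (c-injective (bound u) (bound v) (f-injective _ _ (member u) (member v) e)))

  circuit⇒wide : Circuit C → ∀ l n → l + n ≤ k → 0 < l ⊎ l + n < k → Wide l n
  circuit⇒wide (_ , _ , minimal) l n l+n≤k proper =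
    independent⇒wide l n l+n≤k (minimal (Block l n) Block⊆C (missed proper))
    where
    l+u≤k : ∀ {u} → u ≤ n → l + u ≤ k
    l+u≤k u≤n = ≤-trans (+-monoʳ-≤ l u≤n) l+n≤k
    Block⊆C : Block l n ⊆ C
    Block⊆C y (u , u≤n , e) = l + u , l+u≤k u≤n , e
    missed : 0 < l ⊎ l + n < k → ∃ λ x → C x × ¬ Block l n x
    missed (inj₁ 0<l) = c 0 , (0 , z≤n , refl) , λ (u , u≤n , e) →
      <-irrefl (sym (c-injective (l+u≤k u≤n) z≤n e)) (<-≤-trans 0<l (m≤m+n l u))
    missed (inj₂ l+n<k) = c k , (k , ≤-refl , refl) , λ (u , u≤n , e) →
      <-irrefl (c-injective (l+u≤k u≤n) ≤-refl e) (≤-<-trans (+-monoʳ-≤ l u≤n) l+n<k)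

  greedy : ℕ → ℕ
  greedy zero    = suc (p 0)
  greedy (suc j) = suc (p (suc j)) ⊔ suc (greedy j)

  p<greedy : ∀ j → p j < greedy j
  p<greedy zero    = ≤-refl
  p<greedy (suc j) = m≤m⊔n (suc (p (suc j))) (suc (greedy j))

  greedy-inc : ∀ j → greedy j < greedy (suc j)
  greedy-inc j = m≤n⊔m (suc (p (suc j))) (suc (greedy j))

  greedy-attained : ∀ j → ∃ λ l → ∃ λ n → l + n ≡ j × greedy j ≡ suc (p l + n)
  greedy-attained zero = 0 , 0 , refl , cong suc (sym (+-identityʳ (p 0)))
  greedy-attained (suc j) with ⊔-sel (suc (p (suc j))) (suc (greedy j))
  ... | inj₁ e = suc j , 0 , +-identityʳ (suc j) , trans e (cong suc (sym (+-identityʳ _)))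
  ... | inj₂ e with greedy-attained j
  ...   | l , n , l+n≡j , g≡ = l , suc n , trans (+-suc l n) (cong suc l+n≡j) ,
                               trans e (cong suc (trans g≡ (sym (+-suc (p l) n))))

  all-wide⇒independent : (∀ l n → l + n ≤ k → Wide l n) → Independent C
  all-wide⇒independent wide = matching⇒independent C (λ _ Cy → Cy) greedy matched injective
    where
    greedy≤q : ∀ j → j ≤ k → greedy j ≤ q j
    greedy≤q j j≤k with greedy-attained j
    ... | l , n , refl , g≡ = subst (_≤ q (l + n)) (sym g≡) (wide l n j≤k)
    matched : ∀ j → j ≤ k → C (c j) → InN (greedy j) (c j)
    matched j j≤k _ = bounds⇒InN (p<greedy j) (greedy≤q j j≤k)
    injective : ∀ j j' → j ≤ k → j' ≤ k → C (c j) → C (c j') →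
                greedy j ≡ greedy j' → j ≡ j'
    injective j j' j≤k j'≤k _ _ =
      increasing-injective (λ h _ _ → greedy-inc h) z≤n z≤n j≤k j'≤k

  circuit⇒narrow : Circuit C → q k ≤ p 0 + k
  circuit⇒narrow circuit@(_ , dependent , _) with p 0 + k <? q k
  ... | no ¬wide = ≮⇒≥ ¬wide
  ... | yes wide = ⊥-elim (dependent (all-wide⇒independent all-wide))
    where
    all-wide : ∀ l n → l + n ≤ k → Wide l n
    all-wide (suc l) n l+n≤k = circuit⇒wide circuit (suc l) n l+n≤k (inj₁ (s≤s z≤n))
    all-wide zero    n n≤k with m≤n⇒m<n∨m≡n n≤k
    ... | inj₁ n<k  = circuit⇒wide circuit 0 n n≤k (inj₂ n<k)
    ... | inj₂ refl = wide

  module _ (circuit : Circuit C) where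

    q-above : ∀ j → j < k → p 0 + j < q j
    q-above j j<k = circuit⇒wide circuit 0 j (<⇒≤ j<k) (inj₂ j<k)

    p-below : ∀ j → 1 ≤ j → j ≤ k → p j < p 0 + j
    p-below j 1≤j j≤k = +-cancelʳ-< d (p j) (p 0 + j) (begin-strict
      p j + d         <⟨ circuit⇒wide circuit j d (≤-reflexive j+d≡k) (inj₁ 1≤j) ⟩
      q (j + d)       ≡⟨ cong q j+d≡k ⟩
      q k             ≤⟨ circuit⇒narrow circuit ⟩
      p 0 + k         ≡⟨ cong (p 0 +_) j+d≡k ⟨
      p 0 + (j + d)   ≡⟨ +-assoc (p 0) j d ⟨
      p 0 + j + d     ∎)
      where
      open ≤-Reasoning
      d = k ∸ j
      j+d≡k : j + d ≡ k
      j+d≡k = m+[n∸m]≡n j≤k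

    p≤p0+ : ∀ j → j ≤ k → p j ≤ p 0 + j
    p≤p0+ zero    _     = m≤m+n (p 0) 0
    p≤p0+ (suc j) sj≤k  = <⇒≤ (p-below (suc j) (s≤s z≤n) sj≤k)

    c∈N-right : ∀ j → j < k → InN (p 0 + suc j) (c j)
    c∈N-right j j<k = subst (λ x → InN x (c j)) (sym (+-suc (p 0) j))
      (bounds⇒InN (s≤s (p≤p0+ j (<⇒≤ j<k))) (q-above j j<k))

    c∈N-left : ∀ j → 1 ≤ j → j ≤ k → InN (p 0 + j) (c j)
    c∈N-left (suc j) 1≤j sj≤k = bounds⇒InN (p-below (suc j) 1≤j sj≤k)
      (subst (_≤ q (suc j)) (sym (+-suc (p 0) j))
             (≤-trans (q-above j sj≤k) (q-mono (n≤1+n j) sj≤k)))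

    incidence-interval : incid C ≐ Interval (p 0) (p 0 + k)
    incidence-interval x = to , from
      where
      to : incid C x → Interval (p 0) (p 0 + k) x
      to (_ , _ , _ , (j , j≤k , refl) , x∈N) with InN⇒bounds x∈N
      ... | p<x , x≤q = ≤-<-trans (p-mono z≤n j≤k) p<x ,
                        ≤-trans x≤q (≤-trans (q-mono j≤k ≤-refl) (circuit⇒narrow circuit))
      from : Interval (p 0) (p 0 + k) x → incid C x
      from (p0<x , x≤p0+k) with m≤n⇒∃[o]m+o≡n p0<x
      ... | j , refl = s≤s z≤n , proj₂ (InN⇒range x∈N) ,
                       c j , (j , <⇒≤ j<k , refl) , x∈N
        where
        j<k : j < k
        j<k = +-cancelˡ-≤ (p 0) (suc j) k (subst (_≤ p 0 + k) (sym (+-suc (p 0) j)) x≤p0+k)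
        x∈N = subst (λ y → InN y (c j)) (+-suc (p 0) j) (c∈N-right j j<k)

  Zigzag : (ℕ → ℕ) → Set
  Zigzag i = (∀ j → j < k → InN (i (suc j)) (c j))
           × (∀ j → 1 ≤ j → j ≤ k → InN (i j) (c j))

  Conditions : (ℕ → ℕ) → Set
  Conditions i = (1 ≤ k → InN (i 1) (c 0))
               × (1 ≤ k → InN (i k) (c k))
               × (∀ j → 0 < j → j < k → InN (i j) (c j) × InN (i (suc j)) (c j))

  zigzag⇒conditions : ∀ {i} → Zigzag i → Conditions i
  zigzag⇒conditions (right , left) =
    right 0 , (λ 1≤k → left k 1≤k ≤-refl) , λ j 0<j j<k → left j 0<j (<⇒≤ j<k) , right j j<k

  conditions⇒zigzag : ∀ {i} → Conditions i → Zigzag i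
  conditions⇒zigzag {i} (first , last , middle) = right , left
    where
    right : ∀ j → j < k → InN (i (suc j)) (c j)
    right zero    0<k  = first 0<k
    right (suc j) sj<k = proj₂ (middle (suc j) (s≤s z≤n) sj<k)
    left : ∀ j → 1 ≤ j → j ≤ k → InN (i j) (c j)
    left j 1≤j j≤k with m≤n⇒m<n∨m≡n j≤k
    ... | inj₁ j<k  = proj₁ (middle j 1≤j j<k)
    ... | inj₂ refl = last 1≤j

  module Enumerated {s : ℕ} {i : ℕ → ℕ} (i-inc : ∀ h → 1 ≤ h → h < s → i h < i (suc h))
                    (incidence : incid C ≐ Image i s) where

    circuit⇒enumeration : Circuit C → s ≡ k × (∀ h → 1 ≤ h → h ≤ k → i h ≡ p 0 + h)
    circuit⇒enumeration circuit =
      size , λ h 1≤h h≤k → values h 1≤h (subst (h ≤_) (sym size) h≤k)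
      where
      image : Image i s ≐ Interval (p 0) (p 0 + k)
      image x = proj₁ (incidence-interval circuit x) ∘ proj₂ (incidence x) ,
                proj₁ (incidence x) ∘ proj₂ (incidence-interval circuit x)
      open IntervalEnumeration i-inc image

    circuit⇒zigzag : Circuit C → s ≡ k × Zigzag i
    circuit⇒zigzag circuit with circuit⇒enumeration circuit
    ... | s≡k , i≡ = s≡k , right , left
      where
      right : ∀ j → j < k → InN (i (suc j)) (c j)
      right j j<k =
        subst (λ x → InN x (c j)) (sym (i≡ (suc j) (s≤s z≤n) j<k)) (c∈N-right circuit j j<k)
      left : ∀ j → 1 ≤ j → j ≤ k → InN (i j) (c j)
      left j 1≤j j≤k =
        subst (λ x → InN x (c j)) (sym (i≡ j 1≤j j≤k)) (c∈N-left circuit j 1≤j j≤k)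

    circuit⇒consecutive : Circuit C → ∀ h → 1 ≤ h → h < k → i (suc h) ≡ suc (i h)
    circuit⇒consecutive circuit h 1≤h h<k = begin
      i (suc h)      ≡⟨ i≡ (suc h) (s≤s z≤n) h<k ⟩
      p 0 + suc h    ≡⟨ +-suc (p 0) h ⟩
      suc (p 0 + h)  ≡⟨ cong suc (i≡ h 1≤h (<⇒≤ h<k)) ⟨
      suc (i h)      ∎
      where
      open ≡-Reasoning
      i≡ = proj₂ (circuit⇒enumeration circuit)

    zigzag⇒circuit : (∀ j → j ≤ k → Ground (c j)) → s ≡ k → Zigzag i → Circuit C
    zigzag⇒circuit c-ground s≡k (right , left) = C⊆Ground , dependent , minimal
      where
      ≤s : ∀ {h} → h ≤ k → h ≤ s
      ≤s = subst (_ ≤_) (sym s≡k)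

      i-injective : ∀ {h h'} → 1 ≤ h × h ≤ k → 1 ≤ h' × h' ≤ k → i h ≡ i h' → h ≡ h'
      i-injective (1≤h , h≤k) (1≤h' , h'≤k) =
        increasing-injective i-inc 1≤h 1≤h' (≤s h≤k) (≤s h'≤k)

      C⊆Ground : C ⊆ Ground
      C⊆Ground _ (j , j≤k , refl) = c-ground j j≤k

      dependent : ¬ Independent C
      dependent (f , into , f-injective) = pigeonhole-interval g g∈ g-injective
        where
        member : (x : Fin (suc k)) → C (c (toℕ x))
        member x = toℕ x , toℕ≤pred[n] x , refl
        hit : (x : Fin (suc k)) → Image i s (f (c (toℕ x)))
        hit x with into _ (member x)
        ... | 1≤f , f≤r , f∈N = proj₁ (incidence _) (1≤f , f≤r , _ , member x , f∈N)
        g : Fin (suc k) → ℕ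
        g x = proj₁ (hit x)
        g∈ : ∀ x → 1 ≤ g x × g x < 1 + k
        g∈ x with hit x
        ... | _ , 1≤h , h≤s , _ = 1≤h , s≤s (subst (_ ≤_) s≡k h≤s)
        g-injective : Injective _≡_ _≡_ g
        g-injective {x} {y} e with hit x | hit y
        ... | _ , _ , _ , ix≡ | _ , _ , _ , iy≡ =
          toℕ-injective (c-injective (toℕ≤pred[n] x) (toℕ≤pred[n] y)
            (f-injective _ _ (member x) (member y) (trans (sym ix≡) (trans (cong i e) iy≡))))

      minimal : ∀ (Y : Subset) → Y ⊆ C → (∃ λ x → C x × ¬ Y x) → Independent Y
      minimal Y Y⊆C (_ , (a , a≤k , refl) , ¬Ya) =
        matching⇒independent Y Y⊆C (i ∘ skip a) matched injective
        where
        avoids : ∀ {t} → Y (c t) → t ≢ a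
        avoids Yt refl = ¬Ya Yt
        matched : ∀ t → t ≤ k → Y (c t) → InN (i (skip a t)) (c t)
        matched t t≤k Yt with t <? a
        ... | yes t<a = right t (<-≤-trans t<a a≤k)
        ... | no t≮a  = left t (≤-<-trans z≤n (≮∧≢⇒> t≮a (avoids Yt))) t≤k
        injective : ∀ t t' → t ≤ k → t' ≤ k → Y (c t) → Y (c t') →
                    i (skip a t) ≡ i (skip a t') → t ≡ t'
        injective t t' t≤k t'≤k Yt Yt' =
          skip-injective (avoids Yt) (avoids Yt') ∘ i-injective (skip-range a≤k t≤k (avoids Yt))
                                                                (skip-range a≤k t'≤k (avoids Yt'))

theorem3p9 : ∀ (m r : ℕ) (P Q : LatticePath m r) → Below P Q →
    ∀ (k : ℕ) (c : ℕ → ℕ) →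
    (∀ j → j < k → c j < c (suc j)) →
    (∀ j → j ≤ k → 1 ≤ c j × c j ≤ m + r) →
    ∀ (s : ℕ) (i : ℕ → ℕ) →
    (∀ h → 1 ≤ h → h < s → i h < i (suc h)) →
    (∀ x → (LPM.incid P Q (λ y → ∃ λ j → j ≤ k × c j ≡ y) x
              → ∃ λ h → 1 ≤ h × h ≤ s × i h ≡ x)
         × ((∃ λ h → 1 ≤ h × h ≤ s × i h ≡ x)
              → LPM.incid P Q (λ y → ∃ λ j → j ≤ k × c j ≡ y) x)) →
    ((LPM.Circuit P Q (λ y → ∃ λ j → j ≤ k × c j ≡ y) →
        s ≡ k
        × (1 ≤ k → LPM.InN P Q (i 1) (c 0))
        × (1 ≤ k → LPM.InN P Q (i k) (c k))
        × (∀ j → 0 < j → j < k → LPM.InN P Q (i j) (c j) × LPM.InN P Q (i (suc j)) (c j)))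
     × (s ≡ k
        × (1 ≤ k → LPM.InN P Q (i 1) (c 0))
        × (1 ≤ k → LPM.InN P Q (i k) (c k))
        × (∀ j → 0 < j → j < k → LPM.InN P Q (i j) (c j) × LPM.InN P Q (i (suc j)) (c j))
        → LPM.Circuit P Q (λ y → ∃ λ j → j ≤ k × c j ≡ y)))
    × (LPM.Circuit P Q (λ y → ∃ λ j → j ≤ k × c j ≡ y) →
        ∀ h → 1 ≤ h → h < k → i (suc h) ≡ suc (i h))
theorem3p9 m r P Q P≤Q k c c-inc c-ground s i i-inc incidence =
  ( (λ circuit → let (s≡k , zigzag) = circuit⇒zigzag circuit in s≡k , zigzag⇒conditions zigzag)
  , (λ (s≡k , conditions) → zigzag⇒circuit c-ground s≡k (conditions⇒zigzag conditions)) )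
  , circuit⇒consecutive
  where
  open Chain P Q P≤Q c-inc
  open Enumerated i-inc incidence
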